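{- Let $G$ be a finite simple graph with $n$ vertices and $m$ edges, and suppose that the Mycielskian graph $\mu(G)$ has diameter $2$. Then the Hosoya polynomial of $\mu(G)$ is $$H(\mu(G),x)=(3m+n)\,x+\left(2n^2-3m\right)x^2 .$$
   Context: For a graph $G$ and an integer $k\ge 1$, $d(G,k)$ denotes the number of unordered pairs of distinct vertices of $G$ at (shortest-path) distance exactly $k$. The Hosoya polynomial of a graph $G$ of diameter $D$ is $H(G,x)=\sum_{k=1}^{D} d(G,k)\,x^k$ (no constant term). The Mycielskian graph $\mu(G)$ of a graph $G$ with vertex set $\{v_1,\dots,v_n\}$ has vertex set $\{v_1,\dots,v_n,u_1,\dots,u_n,w\}$ and edge set $E(G)\cup\{wu_i : 1\le i\le n\}\cup\{u_iv_j,\ u_jv_i : v_iv_j\in E(G)\}$. -}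

module Defs where

open import Data.Nat using (ℕ; zero; suc; _+_; _*_; _≤_; _<ᵇ_)
open import Data.Bool using (Bool; true; false; _∧_; _∨_; not; if_then_else_)
open import Data.Fin using (Fin; zero; suc; toℕ; splitAt; _≟_)
open import Data.Sum using (_⊎_; inj₁; inj₂)
open import Data.Product using (Σ; ∃; _×_; _,_)
open import Relation.Nullary.Decidable using (⌊_⌋)
open import Relation.Binary.PropositionalEquality using (_≡_)

record Graph (n : ℕ) : Set where
  field
    adj   : Fin n → Fin n → Bool
    sym   : ∀ i j → adj i j ≡ adj j i
    irrefl : ∀ i → adj i i ≡ false
open Graph public

anyFin : ∀ {n} → (Fin n → Bool) → Bool
anyFin {zero}  f = false
anyFin {suc n} f = f zero ∨ anyFin (λ i → f (suc i))

sumFin : ∀ {n} → (Fin n → ℕ) → ℕ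
sumFin {zero}  f = 0
sumFin {suc n} f = f zero + sumFin (λ i → f (suc i))

countPairs : ∀ {n} → (Fin n → Fin n → Bool) → ℕ
countPairs P = sumFin λ i → sumFin λ j →
  if (toℕ i <ᵇ toℕ j) ∧ P i j then 1 else 0

edges : ∀ {n} → Graph n → ℕ
edges G = countPairs (adj G)

walkOf : ∀ {n} → Graph n → ℕ → Fin n → Fin n → Bool
walkOf G zero    u v = ⌊ u ≟ v ⌋
walkOf G (suc k) u v = anyFin λ w → adj G u w ∧ walkOf G k w v

walkBelow : ∀ {n} → Graph n → ℕ → Fin n → Fin n → Bool
walkBelow G zero    u v = false
walkBelow G (suc k) u v = walkBelow G k u v ∨ walkOf G k u v

distIs : ∀ {n} → Graph n → ℕ → Fin n → Fin n → Bool
distIs G k u v = walkOf G k u v ∧ not (walkBelow G k u v)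

d : ∀ {n} → Graph n → ℕ → ℕ
d G k = countPairs (distIs G k)

HasDiameter : ∀ {n} → Graph n → ℕ → Set
HasDiameter G D =
  (∀ u v → walkBelow G (suc D) u v ≡ true) ×
  (Σ _ λ u → Σ _ λ v → distIs G D u v ≡ true)

-- Hosoya polynomial H(G,x) = Σ_{k≥1} d(G,k) x^k, as its coefficient function
-- (coefficient of x^k for k ≥ 1; no constant term).
hosoyaCoeff : ∀ {n} → Graph n → ℕ → ℕ
hosoyaCoeff G zero    = 0
hosoyaCoeff G (suc k) = d G (suc k)

-- coefficient function of the polynomial a x + b x^2
linQuad : ℕ → ℕ → ℕ → ℕ
linQuad a b 1 = a
linQuad a b 2 = b
linQuad a b _ = 0

-- Mycielskian. Vertex set Fin (suc (n + n)):
--   zero          ↦ w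
--   suc (inj₁ i)  ↦ v_i   (via splitAt n)
--   suc (inj₂ i)  ↦ u_i
data MV (n : ℕ) : Set where
  vv : Fin n → MV n
  uu : Fin n → MV n
  ww : MV n

decode : ∀ {n} → Fin (suc (n + n)) → MV n
decode zero = ww
decode {n} (suc x) with splitAt n x
... | inj₁ i = vv i
... | inj₂ i = uu i

myAdj : ∀ {n} → Graph n → MV n → MV n → Bool
myAdj G (vv i) (vv j) = adj G i j
myAdj G (vv i) (uu j) = adj G i j
myAdj G (uu i) (vv j) = adj G i j
myAdj G (uu i) (uu j) = false
myAdj G (uu i) ww     = true
myAdj G ww     (uu j) = true
myAdj G (vv i) ww     = false
myAdj G ww     (vv j) = false
myAdj G ww     ww     = false

myAdj-sym : ∀ {n} (G : Graph n) x y → myAdj G x y ≡ myAdj G y x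
myAdj-sym G (vv i) (vv j) = sym G i j
myAdj-sym G (vv i) (uu j) = sym G i j
myAdj-sym G (uu i) (vv j) = sym G i j
myAdj-sym G (uu i) (uu j) = Relation.Binary.PropositionalEquality.refl
myAdj-sym G (uu i) ww     = Relation.Binary.PropositionalEquality.refl
myAdj-sym G ww     (uu j) = Relation.Binary.PropositionalEquality.refl
myAdj-sym G (vv i) ww     = Relation.Binary.PropositionalEquality.refl
myAdj-sym G ww     (vv j) = Relation.Binary.PropositionalEquality.refl
myAdj-sym G ww     ww     = Relation.Binary.PropositionalEquality.refl

myAdj-irr : ∀ {n} (G : Graph n) x → myAdj G x x ≡ false
myAdj-irr G (vv i) = irrefl G i
myAdj-irr G (uu i) = Relation.Binary.PropositionalEquality.refl
myAdj-irr G ww     = Relation.Binary.PropositionalEquality.refl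

mycielskian : ∀ {n} → Graph n → Graph (suc (n + n))
mycielskian G = record
  { adj    = λ x y → myAdj G (decode x) (decode y)
  ; sym    = λ x y → myAdj-sym G (decode x) (decode y)
  ; irrefl = λ x → myAdj-irr G (decode x)
  }

{-# OPTIONS --safe #-}
module Submission where

-- In a graph of diameter 2 two distinct vertices are at distance 1 if they
-- are adjacent and at distance 2 otherwise, so H(x) = e x + (p − e) x² with
-- e edges and p pairs of vertices.  μ(G) has 2n + 1 vertices, hence
-- p = 2n² + n, and its degrees deg v_i = 2 deg_G v_i, deg u_i = deg_G v_i + 1,
-- deg w = n sum to 6m + 2n, so by the handshake lemma e = 3m + n.

open import Defs hiding (sym)
open import Data.Nat using (ℕ; zero; suc; _+_; _*_; _∸_; _<ᵇ_)
open import Data.Nat.Properties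
  using (<ᵇ⇒<; <-irrefl; +-suc; +-assoc; +-identityʳ; +-comm; *-identityʳ; *-zeroʳ;
         *-cancelˡ-≡; +-cancelʳ-≡; m+n∸m≡n; [m+n]∸[m+o]≡n∸o)
open import Data.Nat.Tactic.RingSolver using (solve-∀)
open import Data.Bool using (Bool; true; false; _∧_; _∨_; not; if_then_else_; T)
open import Data.Bool.Properties using (∧-identityʳ; ∧-zeroʳ; ∨-identityʳ)
open import Data.Fin using (Fin; zero; suc; toℕ; _↑ˡ_; _↑ʳ_; _≟_)
open import Data.Fin.Properties using (splitAt-↑ˡ; splitAt-↑ʳ)
open import Data.Product using (_,_)
open import Function using (_∘_)
open import Relation.Nullary.Decidable using (⌊_⌋; isYes≗does; dec-false)
open import Relation.Binary.PropositionalEquality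
open ≡-Reasoning

-- Definitionally the summand of countPairs.
indicator : Bool → ℕ
indicator b = if b then 1 else 0

sumFin-cong : ∀ {n} {f g : Fin n → ℕ} → (∀ i → f i ≡ g i) → sumFin f ≡ sumFin g
sumFin-cong {zero}  f≗g = refl
sumFin-cong {suc n} f≗g = cong₂ _+_ (f≗g zero) (sumFin-cong (f≗g ∘ suc))

sumFin-distrib-+ : ∀ {n} (f g : Fin n → ℕ) →
  sumFin (λ i → f i + g i) ≡ sumFin f + sumFin g
sumFin-distrib-+ {zero}  f g = refl
sumFin-distrib-+ {suc n} f g = begin
    (f zero + g zero) + sumFin (λ i → f (suc i) + g (suc i))
  ≡⟨ cong ((f zero + g zero) +_) (sumFin-distrib-+ (f ∘ suc) (g ∘ suc)) ⟩
    (f zero + g zero) + (sumFin (f ∘ suc) + sumFin (g ∘ suc))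
  ≡⟨ interchange (f zero) (g zero) _ _ ⟩
    (f zero + sumFin (f ∘ suc)) + (g zero + sumFin (g ∘ suc))
  ∎
  where
  interchange : ∀ a b c e → (a + b) + (c + e) ≡ (a + c) + (b + e)
  interchange = solve-∀

sumFin-const : ∀ n c → sumFin {n} (λ _ → c) ≡ n * c
sumFin-const zero    c = refl
sumFin-const (suc n) c = cong (c +_) (sumFin-const n c)

sumFin-zero : ∀ n → sumFin {n} (λ _ → 0) ≡ 0
sumFin-zero n = trans (sumFin-const n 0) (*-zeroʳ n)

sumFin-one : ∀ n → sumFin {n} (λ _ → 1) ≡ n
sumFin-one n = trans (sumFin-const n 1) (*-identityʳ n)

sumFin-split : ∀ m n (f : Fin (m + n) → ℕ) →
  sumFin f ≡ sumFin (λ i → f (i ↑ˡ n)) + sumFin (λ i → f (m ↑ʳ i))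
sumFin-split zero    n f = refl
sumFin-split (suc m) n f =
  trans (cong (f zero +_) (sumFin-split m n (f ∘ suc))) (sym (+-assoc (f zero) _ _))

orderedCount : ∀ {n} → (Fin n → Fin n → Bool) → ℕ
orderedCount P = sumFin λ i → sumFin λ j → indicator (P i j)

diagonalCount : ∀ {n} → (Fin n → Fin n → Bool) → ℕ
diagonalCount P = sumFin λ i → indicator (P i i)

pairs : ℕ → ℕ
pairs n = countPairs {n} (λ _ _ → true)

orderedCount-symmetric : ∀ {n} (P : Fin n → Fin n → Bool) → (∀ i j → P i j ≡ P j i) →
  orderedCount P ≡ 2 * countPairs P + diagonalCount P
orderedCount-symmetric {zero}  P P-sym = refl
-- The right-hand side unfolds to 2 * (b + countPairs P′) + …: the guard of
-- countPairs holds on row zero off the diagonal and fails on column zero.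
orderedCount-symmetric {suc n} P P-sym = begin
    (a + b) + sumFin (λ i → indicator (P (suc i) zero) + row i)
  ≡⟨ cong ((a + b) +_) (sumFin-distrib-+ (λ i → indicator (P (suc i) zero)) row) ⟩
    (a + b) + (sumFin (λ i → indicator (P (suc i) zero)) + orderedCount P′)
  ≡⟨ cong₂ (λ x y → (a + b) + (x + y))
       (sumFin-cong (λ i → cong indicator (P-sym (suc i) zero)))
       (orderedCount-symmetric P′ (λ i j → P-sym (suc i) (suc j))) ⟩
    (a + b) + (b + (2 * countPairs P′ + diagonalCount P′))
  ≡⟨ regroup a b (countPairs P′) (diagonalCount P′) ⟩
    2 * (b + countPairs P′) + (a + diagonalCount P′)
  ∎
  where
  P′ : Fin n → Fin n → Bool
  P′ i j = P (suc i) (suc j)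
  a b : ℕ
  a = indicator (P zero zero)
  b = sumFin λ j → indicator (P zero (suc j))
  row : Fin n → ℕ
  row i = sumFin λ j → indicator (P′ i j)
  regroup : ∀ a b c e → (a + b) + (b + (2 * c + e)) ≡ 2 * (b + c) + (a + e)
  regroup = solve-∀

countPairs-cong : ∀ {n} {P Q : Fin n → Fin n → Bool} →
  (∀ i j → i ≢ j → P i j ≡ Q i j) → countPairs P ≡ countPairs Q
countPairs-cong {P = P} {Q} P≐Q = sumFin-cong λ i → sumFin-cong λ j → guarded i j
  where
  guarded : ∀ i j → indicator ((toℕ i <ᵇ toℕ j) ∧ P i j) ≡ indicator ((toℕ i <ᵇ toℕ j) ∧ Q i j)
  guarded i j with toℕ i <ᵇ toℕ j in i<j
  ... | false = refl
  ... | true  = cong indicator (P≐Q i j λ i≡j →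
    <-irrefl (cong toℕ i≡j) (<ᵇ⇒< (toℕ i) (toℕ j) (subst T (sym i<j) _)))

countPairs-complement : ∀ {n} (P : Fin n → Fin n → Bool) →
  countPairs P + countPairs (λ i j → not (P i j)) ≡ pairs n
countPairs-complement {n} P =
  trans (sym (sumFin-distrib-+ {n} _ _)) (sumFin-cong λ i →
  trans (sym (sumFin-distrib-+ {n} _ _)) (sumFin-cong λ j →
  indicator-split (toℕ i <ᵇ toℕ j) (P i j)))
  where
  indicator-split : ∀ b p → indicator (b ∧ p) + indicator (b ∧ not p) ≡ indicator (b ∧ true)
  indicator-split false p     = refl
  indicator-split true  false = refl
  indicator-split true  true  = refl

countPairs-false : ∀ n → countPairs {n} (λ _ _ → false) ≡ 0
countPairs-false n = begin
    countPairs {n} (λ _ _ → false)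
  ≡⟨ sumFin-cong {n} (λ i → sumFin-cong {n} λ j → cong indicator (∧-zeroʳ (toℕ i <ᵇ toℕ j))) ⟩
    sumFin {n} (λ _ → sumFin {n} λ _ → 0)
  ≡⟨ trans (sumFin-cong {n} (λ _ → sumFin-zero n)) (sumFin-zero n) ⟩
    0
  ∎

pairs-double : ∀ n → 2 * pairs n + n ≡ n * n
pairs-double n = begin
    2 * pairs n + n
  ≡⟨ cong (2 * pairs n +_) (sym (sumFin-one n)) ⟩
    2 * pairs n + diagonalCount {n} (λ _ _ → true)
  ≡⟨ sym (orderedCount-symmetric {n} (λ _ _ → true) (λ _ _ → refl)) ⟩
    orderedCount {n} (λ _ _ → true)
  ≡⟨ trans (sumFin-cong {n} (λ _ → sumFin-one n)) (sumFin-const n n) ⟩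
    n * n
  ∎

pairs-odd : ∀ n → pairs (suc (n + n)) ≡ 2 * (n * n) + n
pairs-odd n = *-cancelˡ-≡ _ _ 2 (+-cancelʳ-≡ (suc (n + n)) _ _
  (trans (pairs-double (suc (n + n))) (square n)))
  where
  square : ∀ n → suc (n + n) * suc (n + n) ≡ 2 * (2 * (n * n) + n) + suc (n + n)
  square = solve-∀

degree : ∀ {n} → Graph n → Fin n → ℕ
degree G i = sumFin λ j → indicator (adj G i j)

handshake : ∀ {n} (G : Graph n) → sumFin (degree G) ≡ 2 * edges G
handshake {n} G = begin
    orderedCount (adj G)
  ≡⟨ orderedCount-symmetric (adj G) (Graph.sym G) ⟩
    2 * edges G + diagonalCount (adj G)
  ≡⟨ cong (2 * edges G +_) (trans (sumFin-cong (cong indicator ∘ irrefl G)) (sumFin-zero n)) ⟩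
    2 * edges G + 0
  ≡⟨ +-identityʳ _ ⟩
    2 * edges G
  ∎

anyFin-false : ∀ n → anyFin {n} (λ _ → false) ≡ false
anyFin-false zero    = refl
anyFin-false (suc n) = anyFin-false n

anyFin-cong : ∀ {n} {f g : Fin n → Bool} → (∀ i → f i ≡ g i) → anyFin f ≡ anyFin g
anyFin-cong {zero}  f≗g = refl
anyFin-cong {suc n} f≗g = cong₂ _∨_ (f≗g zero) (anyFin-cong (f≗g ∘ suc))

isYes-≟-suc : ∀ {n} (i j : Fin n) → ⌊ suc i ≟ suc j ⌋ ≡ ⌊ i ≟ j ⌋
isYes-≟-suc i j = trans (isYes≗does (suc i ≟ suc j)) (sym (isYes≗does (i ≟ j)))

isYes-≢ : ∀ {n} {i j : Fin n} → i ≢ j → ⌊ i ≟ j ⌋ ≡ false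
isYes-≢ {i = i} {j} i≢j = trans (isYes≗does (i ≟ j)) (dec-false (i ≟ j) i≢j)

anyFin-select : ∀ {n} (f : Fin n → Bool) j → anyFin (λ i → f i ∧ ⌊ i ≟ j ⌋) ≡ f j
anyFin-select {suc n} f zero = begin
    f zero ∧ true ∨ anyFin (λ i → f (suc i) ∧ false)
  ≡⟨ cong₂ _∨_ (∧-identityʳ (f zero))
       (trans (anyFin-cong (λ i → ∧-zeroʳ (f (suc i)))) (anyFin-false n)) ⟩
    f zero ∨ false
  ≡⟨ ∨-identityʳ (f zero) ⟩
    f zero
  ∎
anyFin-select {suc n} f (suc j) = begin
    f zero ∧ false ∨ anyFin (λ i → f (suc i) ∧ ⌊ suc i ≟ suc j ⌋)
  ≡⟨ cong₂ _∨_ (∧-zeroʳ (f zero))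
       (anyFin-cong (λ i → cong (f (suc i) ∧_) (isYes-≟-suc i j))) ⟩
    anyFin (λ i → f (suc i) ∧ ⌊ i ≟ j ⌋)
  ≡⟨ anyFin-select (f ∘ suc) j ⟩
    f (suc j)
  ∎

∨-true⇒∧-not : ∀ a b → a ∨ b ≡ true → b ∧ not a ≡ not a
∨-true⇒∧-not false true  _ = refl
∨-true⇒∧-not true  b     _ = ∧-zeroʳ b

module _ {N : ℕ} (G : Graph N) where

  walkOf-1 : ∀ u v → walkOf G 1 u v ≡ adj G u v
  walkOf-1 u v = anyFin-select (adj G u) v

  walkBelow-1 : ∀ {u v} → u ≢ v → walkBelow G 1 u v ≡ false
  walkBelow-1 = isYes-≢

  walkBelow-2 : ∀ {u v} → u ≢ v → walkBelow G 2 u v ≡ adj G u v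
  walkBelow-2 {u} {v} u≢v = cong₂ _∨_ (walkBelow-1 u≢v) (walkOf-1 u v)

  walkBelow-mono : ∀ k j {u v} → walkBelow G k u v ≡ true → walkBelow G (k + j) u v ≡ true
  walkBelow-mono k zero          below rewrite +-identityʳ k = below
  walkBelow-mono k (suc j) {u} {v} below rewrite +-suc k j =
    cong (_∨ walkOf G (k + j) u v) (walkBelow-mono k j below)

  distIs-1 : ∀ {u v} → u ≢ v → distIs G 1 u v ≡ adj G u v
  distIs-1 {u} {v} u≢v rewrite walkOf-1 u v | walkBelow-1 u≢v = ∧-identityʳ (adj G u v)

  distIs-2 : ∀ {u v} → u ≢ v → walkBelow G 3 u v ≡ true → distIs G 2 u v ≡ not (adj G u v)
  distIs-2 u≢v below rewrite walkBelow-2 u≢v = ∨-true⇒∧-not _ _ below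

  distIs-beyond : ∀ k {u v} → walkBelow G k u v ≡ true → distIs G k u v ≡ false
  distIs-beyond k {u} {v} below rewrite below = ∧-zeroʳ (walkOf G k u v)

  d-1 : d G 1 ≡ edges G
  d-1 = countPairs-cong λ _ _ → distIs-1

  module _ (within2 : ∀ u v → walkBelow G 3 u v ≡ true) where

    d-2 : d G 2 ≡ pairs N ∸ edges G
    d-2 = begin
        d G 2
      ≡⟨ countPairs-cong (λ u v u≢v → distIs-2 u≢v (within2 u v)) ⟩
        countPairs (λ u v → not (adj G u v))
      ≡⟨ sym (m+n∸m≡n (edges G) _) ⟩
        edges G + countPairs (λ u v → not (adj G u v)) ∸ edges G
      ≡⟨ cong (_∸ edges G) (countPairs-complement (adj G)) ⟩
        pairs N ∸ edges G
      ∎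

    d-beyond : ∀ j → d G (3 + j) ≡ 0
    d-beyond j = trans
      (countPairs-cong λ u v _ → distIs-beyond (3 + j) (walkBelow-mono 3 j (within2 u v)))
      (countPairs-false N)

    hosoyaCoeff-diameter2 : ∀ k → hosoyaCoeff G k ≡ linQuad (edges G) (pairs N ∸ edges G) k
    hosoyaCoeff-diameter2 0                   = refl
    hosoyaCoeff-diameter2 1                   = d-1
    hosoyaCoeff-diameter2 2                   = d-2
    hosoyaCoeff-diameter2 (suc (suc (suc j))) = d-beyond j

sumMV : ∀ {n} → (MV n → ℕ) → ℕ
sumMV f = f ww + (sumFin (f ∘ vv) + sumFin (f ∘ uu))

decode-↑ˡ : ∀ {n} (i : Fin n) → decode {n} (suc (i ↑ˡ n)) ≡ vv i
decode-↑ˡ {n} i rewrite splitAt-↑ˡ n i n = refl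

decode-↑ʳ : ∀ {n} (i : Fin n) → decode {n} (suc (n ↑ʳ i)) ≡ uu i
decode-↑ʳ {n} i rewrite splitAt-↑ʳ n n i = refl

sumFin-decode : ∀ {n} (f : MV n → ℕ) → sumFin (f ∘ decode {n}) ≡ sumMV f
sumFin-decode {n} f = cong (f ww +_)
  (trans (sumFin-split n n (f ∘ decode ∘ suc))
         (cong₂ _+_ (sumFin-cong (cong f ∘ decode-↑ˡ)) (sumFin-cong (cong f ∘ decode-↑ʳ))))

module _ {n : ℕ} (G : Graph n) where

  μdegree : MV n → ℕ
  μdegree a = sumMV λ b → indicator (myAdj G a b)

  degree-mycielskian : sumFin (degree (mycielskian G)) ≡ sumMV μdegree
  degree-mycielskian =
    trans (sumFin-cong (λ x → sumFin-decode (λ b → indicator (myAdj G (decode x) b))))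
          (sumFin-decode μdegree)

  μdegree-ww : μdegree ww ≡ n
  μdegree-ww = cong₂ _+_ (sumFin-zero n) (sumFin-one n)

  μdegree-uu : ∀ i → μdegree (uu i) ≡ 1 + degree G i
  μdegree-uu i = cong suc (trans (cong (degree G i +_) (sumFin-zero n)) (+-identityʳ _))

  sum-μdegree : sumMV μdegree ≡ 2 * n + 3 * sumFin (degree G)
  sum-μdegree = begin
      μdegree ww + (sumFin (λ i → degree G i + degree G i) + sumFin (μdegree ∘ uu))
    ≡⟨ cong₂ (λ x y → x + (sumFin (λ i → degree G i + degree G i) + y))
         μdegree-ww (sumFin-cong μdegree-uu) ⟩
      n + (sumFin (λ i → degree G i + degree G i) + sumFin (λ i → 1 + degree G i))
    ≡⟨ cong₂ (λ x y → n + (x + y))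
         (sumFin-distrib-+ (degree G) (degree G))
         (trans (sumFin-distrib-+ (λ _ → 1) (degree G)) (cong (_+ S) (sumFin-one n))) ⟩
      n + ((S + S) + (n + S))
    ≡⟨ collect n S ⟩
      2 * n + 3 * S
    ∎
    where
    S = sumFin (degree G)
    collect : ∀ n s → n + ((s + s) + (n + s)) ≡ 2 * n + 3 * s
    collect = solve-∀

  edges-mycielskian : edges (mycielskian G) ≡ 3 * edges G + n
  edges-mycielskian = *-cancelˡ-≡ _ _ 2 (begin
      2 * edges (mycielskian G)
    ≡⟨ sym (handshake (mycielskian G)) ⟩
      sumFin (degree (mycielskian G))
    ≡⟨ trans degree-mycielskian sum-μdegree ⟩
      2 * n + 3 * sumFin (degree G)
    ≡⟨ cong (λ s → 2 * n + 3 * s) (handshake G) ⟩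
      2 * n + 3 * (2 * edges G)
    ≡⟨ collect n (edges G) ⟩
      2 * (3 * edges G + n)
    ∎)
    where
    collect : ∀ n m → 2 * n + 3 * (2 * m) ≡ 2 * (3 * m + n)
    collect = solve-∀

lemma3p4 : ∀ {n} (G : Graph n) →
    HasDiameter (mycielskian G) 2 →
    ∀ k → hosoyaCoeff (mycielskian G) k
            ≡ linQuad (3 * edges G + n) (2 * (n * n) ∸ 3 * edges G) k
lemma3p4 {n} G (within2 , _) k = begin
    hosoyaCoeff (mycielskian G) k
  ≡⟨ hosoyaCoeff-diameter2 (mycielskian G) within2 k ⟩
    linQuad (edges (mycielskian G)) (pairs (suc (n + n)) ∸ edges (mycielskian G)) k
  ≡⟨ cong₂ (λ e p → linQuad e (p ∸ e) k) (edges-mycielskian G) (pairs-odd n) ⟩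
    linQuad (3 * m + n) ((2 * (n * n) + n) ∸ (3 * m + n)) k
  ≡⟨ cong (λ p → linQuad (3 * m + n) p k) (∸-cancel-+n (2 * (n * n)) (3 * m)) ⟩
    linQuad (3 * m + n) (2 * (n * n) ∸ 3 * m) k
  ∎
  where
  m = edges G
  ∸-cancel-+n : ∀ a b → (a + n) ∸ (b + n) ≡ a ∸ b
  ∸-cancel-+n a b = trans (cong₂ _∸_ (+-comm a n) (+-comm b n)) ([m+n]∸[m+o]≡n∸o n a b)
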